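{- Let $k$ and $n$ be positive integers and let $\langle t_1,\dots,t_\ell\rangle$ be a sequence of $(k,n)$-tuples such that for every $i\in\{2,\dots,\ell\}$, $t_i$ is a $2$-change of $t_{i-1}$. Then $\ell\le 1+\frac{k+1}{2}\cdot n$.
   Context: A $(k,n)$-tuple is a $k$-tuple $t=(t[1],\dots,t[k])$ of non-negative integers sorted in nondecreasing order with $\sum_i t[i]=n$. For $x<y$ in $\{1,\dots,k\}$ with $t[x]+2\le t[y]$ and $\delta\in\{1,\dots,t[y]-t[x]-1\}$, an $(x,y)$-change of $t$ of order $\delta$ is the $(k,n)$-tuple whose entries are exactly the multiset $\{t[i]: i\ne x,y\}\cup\{t[x]+\delta,\,t[y]-\delta\}$ (sorted nondecreasingly); a $2$-change of $t$ is an $(x,y)$-change of $t$ of some order $\delta$ for some such $x<y$. -}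

module Defs where

open import Data.Nat using (ℕ; zero; suc; _+_; _*_; _∸_; _≤_; _<_)
open import Data.Fin using (Fin) renaming (_<_ to _<ᶠ_)
open import Data.Fin.Properties using () renaming (_≟_ to _≟ᶠ_)
open import Data.Vec using (Vec; lookup; toList)
open import Data.List using (List; []; _∷_; map; filter; length)
open import Data.Nat.ListAction using (sum)
open import Data.List.Relation.Unary.Sorted.TotalOrder using (Sorted)
open import Data.List.Relation.Binary.Permutation.Propositional using (_↭_)
open import Data.Nat.Properties using (≤-totalOrder)
open import Data.Product using (Σ; ∃; _×_; _,_)
open import Data.Bool using (Bool; true; false; _∧_; not)
open import Relation.Nullary.Decidable using (⌊_⌋; ¬?)
open import Relation.Binary.PropositionalEquality using (_≡_)
open import Data.List using (allFin)
open import Relation.Nullary using (¬_)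
open import Data.Sum using (_⊎_)

record Tuple (k n : ℕ) : Set where
  constructor mkTuple
  field
    entries : Vec ℕ k
    sorted  : Sorted ≤-totalOrder (toList entries)
    total   : sum (toList entries) ≡ n
open Tuple public

_[_] : ∀ {k n} → Tuple k n → Fin k → ℕ
t [ i ] = lookup (entries t) i

others : ∀ {k n} → Tuple k n → Fin k → Fin k → List ℕ
others {k} t x y =
  map (t [_]) (filter (λ i → ¬? (i ≟ᶠ x)) (filter (λ i → ¬? (i ≟ᶠ y)) (allFin k)))

-- s is an (x,y)-change of t of order δ: side conditions, and the entries of s
-- are exactly (as a multiset) {t[i] : i ≠ x,y} ∪ {t[x]+δ, t[y]-δ}
-- (s is sorted by definition of a tuple, so it is the sorted version).
IsChange : ∀ {k n} → Tuple k n → Fin k → Fin k → ℕ → Tuple k n → Set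
IsChange t x y δ s =
  x <ᶠ y × (t [ x ]) + 2 ≤ t [ y ] × 1 ≤ δ × δ ≤ (t [ y ] ∸ t [ x ]) ∸ 1 ×
  (toList (entries s) ↭ ((t [ x ] + δ) ∷ (t [ y ] ∸ δ) ∷ others t x y))

Is2Change : ∀ {k n} → Tuple k n → Tuple k n → Set
Is2Change {k} t s = Σ (Fin k) λ x → Σ (Fin k) λ y → Σ ℕ λ δ → IsChange t x y δ s

data Chain {k n : ℕ} : List (Tuple k n) → Set where
  []  : Chain []
  [_] : ∀ t → Chain (t ∷ [])
  _∷_ : ∀ {t u ts} → Is2Change t u → Chain (u ∷ ts) → Chain (t ∷ u ∷ ts)

-- The potential of a tuple is Σ_{i<j} min(t[i], t[j]). It is at most k·n/2, since
-- min(a, b) ≤ (a + b)/2, and every 2-change raises it by at least one: moving two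
-- entries a < b strictly towards each other with their sum fixed raises min(a, b),
-- and cannot lower min(a, c) + min(b, c) for any third entry c. Hence a chain has at
-- most 1 + k·n/2 ≤ 1 + (k+1)·n/2 tuples.
module Submission where

open import Defs renaming ([_] to [_]ᶜ)
open import Data.Nat using (ℕ; suc; _+_; _*_; _≤_; _<_; _∸_; _⊓_; z≤n; s≤s)
open import Data.Nat.Properties
open import Data.Nat.ListAction using (sum)
open import Data.Nat.Tactic.RingSolver using (solve-∀)
open import Data.Nat.ListAction.Properties using (sum-↭)
open import Algebra.Properties.CommutativeSemigroup +-commutativeSemigroup
  using (interchange; x∙yz≈y∙xz)
open import Data.List using (List; []; _∷_; length; map; filter; allFin; tabulate)
open import Data.List.Properties using (filter-all; map-tabulate)
open import Data.Vec using (Vec; toList; lookup)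
import Data.Vec as Vec
open import Data.Vec.Properties using (length-toList)
open import Data.Fin.Properties using () renaming (_≟_ to _≟ᶠ_; <⇒≢ to <ᶠ⇒≢)
open import Data.List.Relation.Binary.Permutation.Propositional
open import Data.List.Relation.Binary.Permutation.Propositional.Properties using (map⁺)
import Data.List.Relation.Unary.All as All
open import Data.List.Relation.Unary.AllPairs using (_∷_)
open import Data.List.Relation.Unary.Any using (here; there)
open import Data.List.Relation.Unary.Unique.Propositional using (Unique)
open import Data.List.Relation.Unary.Unique.Propositional.Properties using (allFin⁺; filter⁺)
open import Data.List.Membership.Propositional using (_∈_)
open import Data.List.Membership.Propositional.Properties using (∈-allFin; ∈-filter⁺)
open import Data.Product using (_×_; _,_)
open import Data.Sum using (inj₁; inj₂)
open import Data.Empty using (⊥-elim)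
open import Relation.Nullary using (yes; no)
open import Relation.Nullary.Decidable using (¬?)
open import Relation.Binary.Definitions using (DecidableEquality)
open import Relation.Binary.PropositionalEquality as ≡
  using (_≡_; _≢_; refl; sym; ≢-sym; cong; cong₂; subst; subst₂; module ≡-Reasoning)

minSum : ℕ → List ℕ → ℕ
minSum x l = sum (map (x ⊓_) l)

pairMinSum : List ℕ → ℕ
pairMinSum []      = 0
pairMinSum (x ∷ l) = minSum x l + pairMinSum l

minSum-↭ : ∀ x {l l′} → l ↭ l′ → minSum x l ≡ minSum x l′
minSum-↭ x p = sum-↭ (map⁺ (x ⊓_) p)

pairMinSum-↭ : ∀ {l l′} → l ↭ l′ → pairMinSum l ≡ pairMinSum l′
pairMinSum-↭ refl        = refl
pairMinSum-↭ (prep x p)  = cong₂ _+_ (minSum-↭ x p) (pairMinSum-↭ p)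
pairMinSum-↭ (swap {xs = l} {ys = l′} x y p) = begin
  (x ⊓ y + minSum x l) + (minSum y l + pairMinSum l)
    ≡⟨ cong₂ _+_ (cong₂ _+_ (⊓-comm x y) (minSum-↭ x p))
                 (cong₂ _+_ (minSum-↭ y p) (pairMinSum-↭ p)) ⟩
  (y ⊓ x + minSum x l′) + (minSum y l′ + pairMinSum l′)
    ≡⟨ +-assoc (y ⊓ x) _ _ ⟩
  y ⊓ x + (minSum x l′ + (minSum y l′ + pairMinSum l′))
    ≡⟨ cong (y ⊓ x +_) (x∙yz≈y∙xz (minSum x l′) (minSum y l′) (pairMinSum l′)) ⟩
  y ⊓ x + (minSum y l′ + (minSum x l′ + pairMinSum l′))
    ≡⟨ +-assoc (y ⊓ x) _ _ ⟨
  (y ⊓ x + minSum y l′) + (minSum x l′ + pairMinSum l′) ∎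
  where open ≡-Reasoning
pairMinSum-↭ (trans p q) = ≡.trans (pairMinSum-↭ p) (pairMinSum-↭ q)

2*⊓≤+ : ∀ x y → 2 * (x ⊓ y) ≤ x + y
2*⊓≤+ x y = begin
  2 * (x ⊓ y)         ≡⟨ cong (x ⊓ y +_) (+-identityʳ (x ⊓ y)) ⟩
  x ⊓ y + x ⊓ y       ≤⟨ +-mono-≤ (m⊓n≤m x y) (m⊓n≤n x y) ⟩
  x + y               ∎
  where open ≤-Reasoning

2*minSum≤ : ∀ x l → 2 * minSum x l ≤ length l * x + sum l
2*minSum≤ x []      = z≤n
2*minSum≤ x (y ∷ l) = begin
  2 * (x ⊓ y + minSum x l)            ≡⟨ *-distribˡ-+ 2 (x ⊓ y) (minSum x l) ⟩
  2 * (x ⊓ y) + 2 * minSum x l        ≤⟨ +-mono-≤ (2*⊓≤+ x y) (2*minSum≤ x l) ⟩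
  (x + y) + (length l * x + sum l)    ≡⟨ interchange x y (length l * x) (sum l) ⟩
  (x + length l * x) + (y + sum l)    ∎
  where open ≤-Reasoning

2*pairMinSum≤length*sum : ∀ l → 2 * pairMinSum l ≤ length l * sum l
2*pairMinSum≤length*sum []      = z≤n
2*pairMinSum≤length*sum (x ∷ l) = begin
  2 * (minSum x l + pairMinSum l)                  ≡⟨ *-distribˡ-+ 2 (minSum x l) (pairMinSum l) ⟩
  2 * minSum x l + 2 * pairMinSum l                ≤⟨ +-mono-≤ (2*minSum≤ x l) (2*pairMinSum≤length*sum l) ⟩
  (length l * x + sum l) + length l * sum l        ≤⟨ m≤n+m _ x ⟩
  x + ((length l * x + sum l) + length l * sum l)  ≡⟨ expand x (sum l) (length l) ⟩
  suc (length l) * (x + sum l)                     ∎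
  where
  open ≤-Reasoning
  expand : ∀ x s m → x + ((m * x + s) + m * s) ≡ suc m * (x + s)
  expand = solve-∀

⊓-balancing-mono : ∀ {a b p q} c → a ≤ p → a ≤ q → p + q ≡ a + b →
                   a ⊓ c + b ⊓ c ≤ p ⊓ c + q ⊓ c
⊓-balancing-mono {a} {b} {p} {q} c a≤p a≤q p+q≡a+b with ≤-total c p | ≤-total c q
... | inj₁ c≤p | inj₁ c≤q rewrite m≥n⇒m⊓n≡n c≤p | m≥n⇒m⊓n≡n c≤q =
  +-mono-≤ (m⊓n≤n a c) (m⊓n≤n b c)
... | inj₁ c≤p | inj₂ q≤c rewrite m≥n⇒m⊓n≡n c≤p | m≤n⇒m⊓n≡m q≤c =
  subst (a ⊓ c + b ⊓ c ≤_) (+-comm q c) (+-mono-≤ (≤-trans (m⊓n≤m a c) a≤q) (m⊓n≤n b c))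
... | inj₂ p≤c | inj₁ c≤q rewrite m≤n⇒m⊓n≡m p≤c | m≥n⇒m⊓n≡n c≤q =
  +-mono-≤ (≤-trans (m⊓n≤m a c) a≤p) (m⊓n≤n b c)
... | inj₂ p≤c | inj₂ q≤c rewrite m≤n⇒m⊓n≡m p≤c | m≤n⇒m⊓n≡m q≤c =
  subst (a ⊓ c + b ⊓ c ≤_) (sym p+q≡a+b) (+-mono-≤ (m⊓n≤m a c) (m⊓n≤m b c))

minSum-balancing-mono : ∀ {a b p q} l → a ≤ p → a ≤ q → p + q ≡ a + b →
                        minSum a l + minSum b l ≤ minSum p l + minSum q l
minSum-balancing-mono []      _ _ _ = z≤n
minSum-balancing-mono {a} {b} {p} {q} (c ∷ l) a≤p a≤q p+q≡a+b = begin
  (a ⊓ c + minSum a l) + (b ⊓ c + minSum b l)  ≡⟨ interchange (a ⊓ c) _ _ _ ⟩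
  (a ⊓ c + b ⊓ c) + (minSum a l + minSum b l)
    ≤⟨ +-mono-≤ (⊓-balancing-mono c a≤p a≤q p+q≡a+b) (minSum-balancing-mono l a≤p a≤q p+q≡a+b) ⟩
  (p ⊓ c + q ⊓ c) + (minSum p l + minSum q l)  ≡⟨ interchange (p ⊓ c) _ _ _ ⟩
  (p ⊓ c + minSum p l) + (q ⊓ c + minSum q l)  ∎
  where open ≤-Reasoning

Balances : ℕ → ℕ → ℕ → ℕ → Set
Balances a b p q = a < p × a < q × p + q ≡ a + b

pairMinSum-balancing-increase : ∀ {a b p q} l → Balances a b p q →
                                pairMinSum (a ∷ b ∷ l) < pairMinSum (p ∷ q ∷ l)
pairMinSum-balancing-increase {a} {b} {p} {q} l (a<p , a<q , p+q≡a+b) = begin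
  suc ((a ⊓ b + minSum a l) + (minSum b l + pairMinSum l))  ≡⟨ cong suc (regroup (a ⊓ b) _ _ _) ⟩
  suc (a ⊓ b) + ((minSum a l + minSum b l) + pairMinSum l)  ≤⟨ +-mono-≤ a⊓b<p⊓q (+-monoˡ-≤ _ sides) ⟩
  p ⊓ q + ((minSum p l + minSum q l) + pairMinSum l)         ≡⟨ regroup (p ⊓ q) _ _ _ ⟨
  (p ⊓ q + minSum p l) + (minSum q l + pairMinSum l)        ∎
  where
  open ≤-Reasoning
  a⊓b<p⊓q : a ⊓ b < p ⊓ q
  a⊓b<p⊓q = ≤-trans (s≤s (m⊓n≤m a b)) (⊓-glb a<p a<q)
  sides : minSum a l + minSum b l ≤ minSum p l + minSum q l
  sides = minSum-balancing-mono l (<⇒≤ a<p) (<⇒≤ a<q) p+q≡a+b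
  regroup : ∀ w x y z → (w + x) + (y + z) ≡ w + ((x + y) + z)
  regroup = solve-∀

change-balances : ∀ {a b δ} → a + 2 ≤ b → 1 ≤ δ → δ ≤ (b ∸ a) ∸ 1 →
                  Balances a b (a + δ) (b ∸ δ)
change-balances {a} {b} {δ} a+2≤b 1≤δ δ≤b∸a∸1 =
  a<a+δ , m+n≤o⇒m≤o∸n (suc a) suc[a]+δ≤b , a+δ+[b∸δ]≡a+b
  where
  a<a+δ : a < a + δ
  a<a+δ = subst (_≤ a + δ) (+-comm a 1) (+-monoʳ-≤ a 1≤δ)
  δ+[a+1]≤b : δ + (a + 1) ≤ b
  δ+[a+1]≤b = m≤o∸n⇒m+n≤o δ (≤-trans (+-monoʳ-≤ a (s≤s z≤n)) a+2≤b)
                            (subst (δ ≤_) (∸-+-assoc b a 1) δ≤b∸a∸1)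
  suc[a]+δ≤b : suc a + δ ≤ b
  suc[a]+δ≤b = subst (_≤ b) (≡.trans (+-comm δ (a + 1)) (cong (_+ δ) (+-comm a 1))) δ+[a+1]≤b
  a+δ+[b∸δ]≡a+b : (a + δ) + (b ∸ δ) ≡ a + b
  a+δ+[b∸δ]≡a+b = ≡.trans (+-assoc a δ (b ∸ δ)) (cong (a +_) (m+[n∸m]≡n (m+n≤o⇒m≤o δ δ+[a+1]≤b)))

module _ {A : Set} (_≟_ : DecidableEquality A) where

  removeAll : A → List A → List A
  removeAll y = filter (λ z → ¬? (z ≟ y))

  ∈-unique⇒↭∷removeAll : ∀ {y} xs → Unique xs → y ∈ xs → xs ↭ y ∷ removeAll y xs
  ∈-unique⇒↭∷removeAll {y} (z ∷ xs) (z∉xs ∷ xs!) _ with z ≟ y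
  ... | yes refl = prep z (↭-reflexive (sym (filter-all (λ w → ¬? (w ≟ y)) (All.map ≢-sym z∉xs))))
  ∈-unique⇒↭∷removeAll {y} (z ∷ xs) (z∉xs ∷ xs!) (here y≡z) | no z≢y = ⊥-elim (z≢y (sym y≡z))
  ∈-unique⇒↭∷removeAll {y} (z ∷ xs) (z∉xs ∷ xs!) (there y∈xs) | no z≢y =
    ↭-trans (prep z (∈-unique⇒↭∷removeAll xs xs! y∈xs)) (swap z y refl)

toList≡map-lookup-allFin : ∀ {A : Set} {m} (v : Vec A m) → toList v ≡ map (lookup v) (allFin m)
toList≡map-lookup-allFin v = ≡.trans (toList≡tabulate v) (sym (map-tabulate (λ i → i) (lookup v)))
  where
  toList≡tabulate : ∀ {A : Set} {m} (v : Vec A m) → toList v ≡ tabulate (lookup v)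
  toList≡tabulate Vec.[]       = refl
  toList≡tabulate (x Vec.∷ v) = cong (x ∷_) (toList≡tabulate v)

entries-↭-pair∷others : ∀ {k n} (t : Tuple k n) {x y} → x ≢ y →
                        toList (entries t) ↭ t [ x ] ∷ t [ y ] ∷ others t x y
entries-↭-pair∷others {k} t {x} {y} x≢y =
  subst (_↭ t [ x ] ∷ t [ y ] ∷ others t x y) (sym (toList≡map-lookup-allFin (entries t)))
        (map⁺ (t [_]) allFin↭)
  where
  allFin! : Unique (allFin k)
  allFin! = allFin⁺ k
  allFin↭ : allFin k ↭ x ∷ y ∷ removeAll _≟ᶠ_ x (removeAll _≟ᶠ_ y (allFin k))
  allFin↭ = ↭-trans (∈-unique⇒↭∷removeAll _≟ᶠ_ (allFin k) allFin! (∈-allFin y))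
                    (↭-trans (prep y (∈-unique⇒↭∷removeAll _≟ᶠ_ _ rest! x∈rest)) (swap y x refl))
    where
    rest! : Unique (removeAll _≟ᶠ_ y (allFin k))
    rest! = filter⁺ (λ i → ¬? (i ≟ᶠ y)) allFin!
    x∈rest : x ∈ removeAll _≟ᶠ_ y (allFin k)
    x∈rest = ∈-filter⁺ (λ i → ¬? (i ≟ᶠ y)) (∈-allFin x) x≢y

potential : ∀ {k n} → Tuple k n → ℕ
potential t = pairMinSum (toList (entries t))

2*potential≤ : ∀ {k n} (t : Tuple k n) → 2 * potential t ≤ k * n
2*potential≤ t =
  subst₂ (λ m s → 2 * potential t ≤ m * s) (length-toList (entries t)) (total t)
         (2*pairMinSum≤length*sum (toList (entries t)))

potential-2change : ∀ {k n} (t u : Tuple k n) → Is2Change t u → potential t < potential u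
potential-2change t u (x , y , δ , x<y , t[x]+2≤t[y] , 1≤δ , δ≤ , u↭) =
  subst₂ _<_ (sym (pairMinSum-↭ (entries-↭-pair∷others t (<ᶠ⇒≢ x<y)))) (sym (pairMinSum-↭ u↭))
         (pairMinSum-balancing-increase (others t x y) (change-balances t[x]+2≤t[y] 1≤δ δ≤))

chain-length-bound : ∀ {k n} (t : Tuple k n) ts → Chain (t ∷ ts) →
                     2 * (length ts + potential t) ≤ k * n
chain-length-bound t []       [ .t ]ᶜ     = 2*potential≤ t
chain-length-bound t (u ∷ ts) (t→u ∷ ch) = begin
  2 * (suc (length ts) + potential t)  ≡⟨ cong (2 *_) (+-suc (length ts) (potential t)) ⟨
  2 * (length ts + suc (potential t))  ≤⟨ *-monoʳ-≤ 2 (+-monoʳ-≤ (length ts) (potential-2change t u t→u)) ⟩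
  2 * (length ts + potential u)        ≤⟨ chain-length-bound u ts ch ⟩
  _                                    ∎
  where open ≤-Reasoning

lemma6 : (k n : ℕ) → 1 ≤ k → 1 ≤ n → (ts : List (Tuple k n)) → Chain ts →
    2 * length ts ≤ 2 + (k + 1) * n
lemma6 k n _ _ []       _  = z≤n
lemma6 k n _ _ (t ∷ ts) ch = begin
  2 * suc (length ts)                ≡⟨ *-distribˡ-+ 2 1 (length ts) ⟩
  2 + 2 * length ts                  ≤⟨ +-monoʳ-≤ 2 (*-monoʳ-≤ 2 (m≤m+n (length ts) (potential t))) ⟩
  2 + 2 * (length ts + potential t)  ≤⟨ +-monoʳ-≤ 2 (chain-length-bound t ts ch) ⟩
  2 + k * n                          ≤⟨ +-monoʳ-≤ 2 (*-monoˡ-≤ n (m≤m+n k 1)) ⟩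
  2 + (k + 1) * n                    ∎
  where open ≤-Reasoning
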